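{- Let $n>1$, let $F\colon\{0,1\}^n\to\{0,1\}$ be an $n$-dimensional truth-table, and let $\alpha\in 2^\omega$ be proper. Then \[ s^F_\alpha \equiv_{sW} s^{\oplus_{l(F)}}_\alpha. \]
   Context: Cantor space $2^\omega$ carries the lexicographic order $<_{lex}$. For $\alpha\in2^\omega$, $s_\alpha\colon 2^\omega\to\{0,1\}$ is $s_\alpha(x)=0$ if $x<_{lex}\alpha$ and $s_\alpha(x)=1$ if $x\ge_{lex}\alpha$. A sequence $\alpha\in2^\omega$ is proper if it contains infinitely many $1$'s. For an $m$-dimensional truth-table $G\colon\{0,1\}^m\to\{0,1\}$ and $\alpha_1,\dots,\alpha_m\in2^\omega$, $s^G_{\alpha_1,\dots,\alpha_m}\colon(2^\omega)^m\to\{0,1\}$ is $(x_1,\dots,x_m)\mapsto G(s_{\alpha_1}(x_1),\dots,s_{\alpha_m}(x_m))$, and $s^G_\alpha$ abbreviates $s^G_{\alpha,\dots,\alpha}$ (all $m$ thresholds equal to $\alpha$). $\oplus_m$ denotes the $m$-dimensional truth-table computing addition modulo $2$ of its $m$ input bits. For $v,v'\in\{0,1\}^n$, write $v\subseteq v'$ if $v(j)=1$ implies $v'(j)=1$ for all $j$, and $v\subset v'$ if additionally $v\neq v'$. For a truth-table $F$, $l(F)=k-1$ where $k$ is the length of a longest sequence $v_1\subset v_2\subset\dots\subset v_k$ in $\{0,1\}^{n}$ with $F(v_i)\neq F(v_{i+1})$ for all $i<k$. Weihrauch reducibility: for functions $f,g$ between spaces that are finite products of $2^\omega$, $\mathbb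 N$, $\{0,1\}$, we write $f\le_W g$ if there are computable (Turing) functionals $\Phi,\Psi$ with $f(x)=\Psi(x,g(\Phi(x)))$ for all $x$ in the domain of $f$, and $f\le_{sW}g$ (strong Weihrauch reducibility) if $f(x)=\Psi(g(\Phi(x)))$ for all such $x$; $\equiv_W$, $\equiv_{sW}$ denote reducibility in both directions. -}

module Defs where

open import Data.Nat using (ℕ; zero; suc; _<_; _≤_; _<?_)
open import Data.Bool using (Bool; true; false; _xor_)
open import Data.Fin using (Fin; toℕ; fromℕ<)
open import Data.Vec using (Vec; []; _∷_; lookup; foldr)
open import Data.Vec.Relation.Unary.All using (All)
open import Data.List using (List; []; _∷_; length)
open import Data.Product using (Σ; _×_; ∃; _,_)
open import Data.Sum using (_⊎_)
open import Relation.Nullary using (¬_; yes; no)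
open import Relation.Binary.PropositionalEquality using (_≡_; _≢_)

Cantor : Set
Cantor = ℕ → Bool

_<lex_ : Cantor → Cantor → Set
x <lex y = ∃ λ n → (∀ i → i < n → x i ≡ y i) × (x n ≡ false × y n ≡ true)

-- x ≥lex y, i.e. not x <lex y (lexicographic order is total)
_≥lex_ : Cantor → Cantor → Set
x ≥lex y = ¬ (x <lex y)

Proper : Cantor → Set
Proper α = ∀ N → ∃ λ i → N ≤ i × α i ≡ true

S : Cantor → Cantor → Bool → Set
S α x b = (x <lex α × b ≡ false) ⊎ (x ≥lex α × b ≡ true)

TruthTable : ℕ → Set
TruthTable m = Vec Bool m → Bool

SG : ∀ {m} → TruthTable m → Cantor → Vec Cantor m → Bool → Set
SG {m} G α xs b =
  Σ (Vec Bool m) λ v → (∀ (j : Fin m) → S α (lookup xs j) (lookup v j)) × b ≡ G v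

xorTT : (m : ℕ) → TruthTable m
xorTT m v = foldr (λ _ → Bool) _xor_ false v

_⊆b_ : ∀ {n} → Vec Bool n → Vec Bool n → Set
v ⊆b w = ∀ j → lookup v j ≡ true → lookup w j ≡ true

_⊂b_ : ∀ {n} → Vec Bool n → Vec Bool n → Set
v ⊂b w = v ⊆b w × v ≢ w

data AltChain {n} (F : TruthTable n) : List (Vec Bool n) → Set where
  single : ∀ v → AltChain F (v ∷ [])
  step   : ∀ v w vs → v ⊂b w → F v ≢ F w →
           AltChain F (w ∷ vs) → AltChain F (v ∷ w ∷ vs)

-- IsL F L  :⇔  l(F) = L, i.e. the longest alternating chain has length L+1
IsL : ∀ {n} → TruthTable n → ℕ → Set
IsL F L = (Σ (List _) λ c → AltChain F c × length c ≡ suc L)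
        × (∀ c → AltChain F c → length c ≤ suc L)

-- computability: oracle partial recursive (Kleene μ-recursive) functions

data Code : ℕ → Set where
  zero' : ∀ {k} → Code k
  succ' : Code 1
  proj  : ∀ {k} → Fin k → Code k
  orc   : Code 2
  comp  : ∀ {k m} → Code m → Vec (Code k) m → Code k
  prec  : ∀ {k} → Code k → Code (suc (suc k)) → Code (suc k)
  mu    : ∀ {k} → Code (suc k) → Code k

mutual
  data Eval (o : ℕ → ℕ → ℕ) : ∀ {k} → Code k → Vec ℕ k → ℕ → Set where
    ev-zero  : ∀ {k} {xs : Vec ℕ k} → Eval o zero' xs 0
    ev-succ  : ∀ {x} → Eval o succ' (x ∷ []) (suc x)
    ev-proj  : ∀ {k} {xs : Vec ℕ k} (i : Fin k) → Eval o (proj i) xs (lookup xs i)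
    ev-orc   : ∀ {j i} → Eval o orc (j ∷ i ∷ []) (o j i)
    ev-comp  : ∀ {k m} {f : Code m} {gs : Vec (Code k) m} {xs ys y} →
               EvalVec o gs xs ys → Eval o f ys y → Eval o (comp f gs) xs y
    ev-prec0 : ∀ {k} {f : Code k} {g} {xs y} →
               Eval o f xs y → Eval o (prec f g) (0 ∷ xs) y
    ev-precS : ∀ {k} {f : Code k} {g} {n xs y z} →
               Eval o (prec f g) (n ∷ xs) y → Eval o g (n ∷ y ∷ xs) z →
               Eval o (prec f g) (suc n ∷ xs) z
    ev-mu    : ∀ {k} {f : Code (suc k)} {xs n} →
               Eval o f (n ∷ xs) 0 →
               (∀ i → i < n → Σ ℕ λ v → Eval o f (i ∷ xs) (suc v)) →
               Eval o (mu f) xs n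

  data EvalVec (o : ℕ → ℕ → ℕ) : ∀ {k m} → Vec (Code k) m → Vec ℕ k → Vec ℕ m → Set where
    evv-nil  : ∀ {k} {xs : Vec ℕ k} → EvalVec o [] xs []
    evv-cons : ∀ {k m} {g : Code k} {gs : Vec (Code k) m} {xs y ys} →
               Eval o g xs y → EvalVec o gs xs ys → EvalVec o (g ∷ gs) xs (y ∷ ys)

b2n : Bool → ℕ
b2n false = 0
b2n true  = 1

-- a tuple of Cantor sequences as an oracle: o(j,i) = x_j(i) (0 if j out of range)
oracle : ∀ {n} → Vec Cantor n → ℕ → ℕ → ℕ
oracle {n} xs j i with j <? n
... | yes p = b2n (lookup xs (fromℕ< p) i)
... | no _  = 0

Computable : ∀ {n m} → (Vec Cantor n → Vec Cantor m) → Set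
Computable {n} {m} Φ = Σ (Code 2) λ e →
  ∀ (xs : Vec Cantor n) (j : Fin m) (i : ℕ) →
    Eval (oracle xs) e (toℕ j ∷ i ∷ []) (b2n (lookup (Φ xs) j i))

-- strong Weihrauch reducibility between (graphs of) functions
-- f : (2^ω)^n → {0,1} and g : (2^ω)^m → {0,1}.
-- Ψ : {0,1} → {0,1}; every such map is computable.

_≤sW_ : ∀ {n m} → (Vec Cantor n → Bool → Set) → (Vec Cantor m → Bool → Set) → Set
_≤sW_ {n} {m} f g =
  Σ (Vec Cantor n → Vec Cantor m) λ Φ → Computable Φ ×
  Σ (Bool → Bool) λ Ψ → ∀ xs b → g (Φ xs) b → f xs (Ψ b)

_≡sW_ : ∀ {n m} → (Vec Cantor n → Bool → Set) → (Vec Cantor m → Bool → Set) → Set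
f ≡sW g = (f ≤sW g) × (g ≤sW f)

{-# OPTIONS --safe #-}
-- s_α is monotone for the lexicographic order, so it turns the lexicographic minimum and maximum
-- of two sequences into the ∧ and ∨ of their bits; both are computable by an automaton comparing
-- the digit streams. Hence if F = Ψ ∘ G ∘ (M₁, …, M_m) with every M_k monotone, writing each M_k
-- as a lattice term gives s^F_α ≤sW s^G_α.
--
-- Let h(w) be the number of steps of a longest alternating chain starting at w. It is antitone,
-- and F(w) = F(1…1) ⊕ (h(w) mod 2), so F factors through ⊕_l(F) via the monotone thresholds
-- [h(w) ≤ k], k < l(F). Conversely, along a longest alternating chain v₀ ⊂ … ⊂ v_l(F), the
-- monotone map u ↦ v_{|u|} (|u| the number of ones) gives ⊕_l(F)(u) = F(v₀) ⊕ F(v_{|u|}).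
-- Excluded middle enters only to evaluate s_α, to compare two sequences, and to choose h(w).

module Submission where

open import Defs
open import Level using (0ℓ)
open import Axiom.ExcludedMiddle using (ExcludedMiddle)
open import Data.Nat
  using (ℕ; zero; suc; pred; _+_; _∸_; _≤_; _<_; _≤′_; ≤′-refl; ≤′-step; _≤ᵇ_; _<?_;
         z≤n; s≤s; s≤s⁻¹)
open import Data.Nat.Properties
  using (≤-refl; ≤-trans; <-trans; <-cmp; <⇒≤; n≤1+n; 1+n≰n; ≮⇒≥; ≤⇒≤′; ≤ᵇ⇒≤; ≤⇒≤ᵇ;
         m<1+n⇒m<n∨m≡n; m≤n⇒m<n∨m≡n; m+[n∸m]≡n)
open import Data.Bool using (Bool; true; false; not; _∧_; _∨_; _xor_; if_then_else_; T; f≤t; b≤b)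
  renaming (_≤_ to _≤ᴮ_)
open import Data.Bool.Properties
  using (_≟_; ∧-idem; ∧-comm; ∨-idem; ∨-comm; ∨-identityʳ; ¬-not; not-¬; not-involutive;
         not-distribˡ-xor; not-distribʳ-xor; xor-assoc; xor-same; xor-identityʳ; ≤-minimum; ≤-reflexive)
open import Data.Fin using (Fin; toℕ; zero; suc; #_)
open import Data.Fin.Properties using (fromℕ<-toℕ; toℕ<n)
open import Data.Vec using (Vec; []; _∷_; lookup; tabulate; replicate; count)
open import Data.Vec.Properties
  using (lookup∘tabulate; tabulate∘lookup; tabulate-cong; lookup-replicate; count≤n)
open import Data.List using (length)
import Data.List as List
open import Data.Product using (∃; ∃₂; _×_; _,_; proj₁; proj₂)
open import Data.Sum using (_⊎_; inj₁; inj₂; [_,_]′)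
open import Data.Empty using (⊥-elim)
open import Relation.Binary using (tri<; tri≈; tri>)
open import Relation.Nullary using (yes; no)
open import Relation.Nullary.Decidable using (T?; decidable-stable)
open import Relation.Binary.PropositionalEquality
  using (_≡_; _≢_; _≗_; refl; sym; trans; cong; subst; module ≡-Reasoning)
open import Function using (_∘_; id)

odd : ℕ → Bool
odd zero    = false
odd (suc n) = not (odd n)

odd-+ : ∀ m n → odd (m + n) ≡ odd m xor odd n
odd-+ zero    n = refl
odd-+ (suc m) n = trans (cong not (odd-+ m n)) (not-distribˡ-xor (odd m) (odd n))

xor-cancelˡ : ∀ x y → x xor (x xor y) ≡ y
xor-cancelˡ false y = refl
xor-cancelˡ true  y = not-involutive y

xor-cancelʳ : ∀ x y → (x xor y) xor y ≡ x
xor-cancelʳ x y = trans (xor-assoc x y y) (trans (cong (x xor_) (xor-same y)) (xor-identityʳ x))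

odd-∸ : ∀ {h L} → h ≤ L → odd L xor odd (L ∸ h) ≡ odd h
odd-∸ {h} {L} h≤L = begin
  odd L xor odd (L ∸ h)                   ≡˘⟨ cong (λ l → odd l xor odd (L ∸ h)) (m+[n∸m]≡n h≤L) ⟩
  odd (h + (L ∸ h)) xor odd (L ∸ h)       ≡⟨ cong (_xor odd (L ∸ h)) (odd-+ h (L ∸ h)) ⟩
  (odd h xor odd (L ∸ h)) xor odd (L ∸ h) ≡⟨ xor-cancelʳ (odd h) (odd (L ∸ h)) ⟩
  odd h                                   ∎
  where open ≡-Reasoning

x≤y⇒x∧y≡x : ∀ {x y} → x ≤ᴮ y → x ∧ y ≡ x
x≤y⇒x∧y≡x f≤t = refl
x≤y⇒x∧y≡x b≤b = ∧-idem _

x≤y⇒x∨y≡y : ∀ {x y} → x ≤ᴮ y → x ∨ y ≡ y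
x≤y⇒x∨y≡y f≤t = refl
x≤y⇒x∨y≡y b≤b = ∨-idem _

T⇒≤ᴮ : ∀ {x y} → (T x → T y) → x ≤ᴮ y
T⇒≤ᴮ {false}         _   = ≤-minimum _
T⇒≤ᴮ {true}  {true}  _   = b≤b
T⇒≤ᴮ {true}  {false} x⇒y = ⊥-elim (x⇒y _)

≤ᵇ-antitone : ∀ {m n} k → m ≤ n → (n ≤ᵇ k) ≤ᴮ (m ≤ᵇ k)
≤ᵇ-antitone {n = n} k m≤n = T⇒≤ᴮ (λ n≤k → ≤⇒≤ᵇ (≤-trans m≤n (≤ᵇ⇒≤ n k n≤k)))

⊆b-refl : ∀ {n} {v : Vec Bool n} → v ⊆b v
⊆b-refl _ vj = vj

⊆b-trans : ∀ {n} {u v w : Vec Bool n} → u ⊆b v → v ⊆b w → u ⊆b w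
⊆b-trans u⊆v v⊆w j uj = v⊆w j (u⊆v j uj)

⊆b-top : ∀ {n} (v : Vec Bool n) → v ⊆b replicate n true
⊆b-top v j _ = lookup-replicate j true

∷-⊆b : ∀ {n} x {v w : Vec Bool n} → v ⊆b w → (x ∷ v) ⊆b (x ∷ w)
∷-⊆b x v⊆w zero    x≡true = x≡true
∷-⊆b x v⊆w (suc j) vj     = v⊆w j vj

false∷⊆true∷ : ∀ {n} (v : Vec Bool n) → (false ∷ v) ⊆b (true ∷ v)
false∷⊆true∷ v zero    ()
false∷⊆true∷ v (suc j) vj = vj

⊆b⇒lookup-≤ : ∀ {n} {v w : Vec Bool n} → v ⊆b w → ∀ j → lookup v j ≤ᴮ lookup w j
⊆b⇒lookup-≤ {v = v} v⊆w j with lookup v j in vj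
... | false = ≤-minimum _
... | true  = ≤-reflexive (sym (v⊆w j vj))

count-mono : ∀ {n} (v w : Vec Bool n) → v ⊆b w → count T? v ≤ count T? w
count-mono []          []          _   = z≤n
count-mono (true  ∷ v) (true  ∷ w) v⊆w = s≤s (count-mono v w (v⊆w ∘ suc))
count-mono (true  ∷ v) (false ∷ w) v⊆w with () ← v⊆w zero refl
count-mono (false ∷ v) (true  ∷ w) v⊆w = ≤-trans (count-mono v w (v⊆w ∘ suc)) (n≤1+n _)
count-mono (false ∷ v) (false ∷ w) v⊆w = count-mono v w (v⊆w ∘ suc)

xorTT-count : ∀ {m} (u : Vec Bool m) → xorTT m u ≡ odd (count T? u)
xorTT-count []          = refl
xorTT-count (true  ∷ u) = cong not (xorTT-count u)
xorTT-count (false ∷ u) = xorTT-count u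

xorTT-thresholds : ∀ L h → xorTT L (tabulate (λ (k : Fin L) → h ≤ᵇ toℕ k)) ≡ odd (L ∸ h)
xorTT-thresholds zero    zero          = refl
xorTT-thresholds zero    (suc h)       = refl
xorTT-thresholds (suc L) zero          = cong not (xorTT-thresholds L zero)
-- h is split further so that suc h ≤ᵇ suc k computes to h ≤ᵇ k.
xorTT-thresholds (suc L) (suc zero)    = xorTT-thresholds L zero
xorTT-thresholds (suc L) (suc (suc h)) = xorTT-thresholds L (suc h)

-- The lexicographic order and s_α

AgreeBelow : ℕ → Cantor → Cantor → Set
AgreeBelow d a b = ∀ i → i < d → a i ≡ b i

FirstDifference : Cantor → Cantor → Set
FirstDifference a b = ∃ λ d → AgreeBelow d a b × a d ≢ b d

_≤lex_ : Cantor → Cantor → Set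
a ≤lex b = a <lex b ⊎ a ≗ b

<lex-respˡ-≗ : ∀ {a a' c} → a ≗ a' → a <lex c → a' <lex c
<lex-respˡ-≗ a≗a' (d , agree , ad , cd) =
  d , (λ i i<d → trans (sym (a≗a' i)) (agree i i<d)) , trans (sym (a≗a' d)) ad , cd

<lex-trans : ∀ {a b c} → a <lex b → b <lex c → a <lex c
<lex-trans (d , ab , ad , bd) (d' , bc , bd' , cd') with <-cmp d d'
... | tri< d<d' _ _ =
  d , (λ i i<d → trans (ab i i<d) (bc i (<-trans i<d d<d'))) , ad , trans (sym (bc d d<d')) bd
... | tri≈ _ refl _ = ⊥-elim (not-¬ bd bd')
... | tri> _ _ d'<d =
  d' , (λ i i<d' → trans (ab i (<-trans i<d' d'<d)) (bc i i<d')) , trans (ab d' d'<d) bd' , cd'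

≤lex-<lex-trans : ∀ {a b c} → a ≤lex b → b <lex c → a <lex c
≤lex-<lex-trans (inj₁ a<b) b<c = <lex-trans a<b b<c
≤lex-<lex-trans (inj₂ a≗b) b<c = <lex-respˡ-≗ (sym ∘ a≗b) b<c

agree-or-differ : ∀ (a b : Cantor) k → AgreeBelow k a b ⊎ FirstDifference a b
agree-or-differ a b zero = inj₁ (λ _ ())
agree-or-differ a b (suc k) with agree-or-differ a b k
... | inj₂ difference = inj₂ difference
... | inj₁ agree with a k ≟ b k
...   | no  ak≢bk = inj₂ (k , agree , ak≢bk)
...   | yes ak≡bk = inj₁ λ i i<1+k → [ agree i , (λ { refl → ak≡bk }) ]′ (m<1+n⇒m<n∨m≡n i<1+k)

firstDifference : ∀ (a b : Cantor) i → a i ≢ b i → FirstDifference a b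
firstDifference a b i ai≢bi =
  [ (λ agree → ⊥-elim (ai≢bi (agree i ≤-refl))) , id ]′ (agree-or-differ a b (suc i))

≤lex-total : ExcludedMiddle 0ℓ → ∀ a b → a ≤lex b ⊎ b <lex a
≤lex-total em a b with em {∃ λ i → a i ≢ b i}
... | no ¬difference =
  inj₁ (inj₂ λ i → decidable-stable (a i ≟ b i) (λ ai≢bi → ¬difference (i , ai≢bi)))
... | yes (i , ai≢bi) with firstDifference a b i ai≢bi
...   | d , agree , ad≢bd with a d in ad | b d in bd
...     | false | true  = inj₁ (inj₁ (d , agree , ad , bd))
...     | true  | false = inj₂ (d , (λ j j<d → sym (agree j j<d)) , bd , ad)
...     | false | false = ⊥-elim (ad≢bd refl)
...     | true  | true  = ⊥-elim (ad≢bd refl)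

module _ {α : Cantor} where

  S-resp-≗ : ∀ {a a' s} → a ≗ a' → S α a s → S α a' s
  S-resp-≗ a≗a' (inj₁ (a<α , s≡0)) = inj₁ (<lex-respˡ-≗ a≗a' a<α , s≡0)
  S-resp-≗ a≗a' (inj₂ (a≥α , s≡1)) = inj₂ (a≥α ∘ <lex-respˡ-≗ (sym ∘ a≗a') , s≡1)

  S-functional : ∀ {a s s'} → S α a s → S α a s' → s ≡ s'
  S-functional (inj₁ (_   , refl)) (inj₁ (_   , refl)) = refl
  S-functional (inj₁ (a<α , _))    (inj₂ (a≥α , _))    = ⊥-elim (a≥α a<α)
  S-functional (inj₂ (a≥α , _))    (inj₁ (a<α , _))    = ⊥-elim (a≥α a<α)
  S-functional (inj₂ (_   , refl)) (inj₂ (_   , refl)) = refl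

  S-monotone : ∀ {a b sa sb} → a ≤lex b → S α a sa → S α b sb → sa ≤ᴮ sb
  S-monotone a≤b (inj₁ (_   , refl)) _                   = ≤-minimum _
  S-monotone a≤b (inj₂ (_   , refl)) (inj₂ (_   , refl)) = b≤b
  S-monotone a≤b (inj₂ (a≥α , _))    (inj₁ (b<α , _))    = ⊥-elim (a≥α (≤lex-<lex-trans a≤b b<α))

  S-total : ExcludedMiddle 0ℓ → ∀ a → ∃ (S α a)
  S-total em a with em {a <lex α}
  ... | yes a<α = false , inj₁ (a<α , refl)
  ... | no  a≥α = true  , inj₂ (a≥α , refl)

  S-ones : S α (λ _ → true) true
  S-ones = inj₂ ((λ { (_ , _ , () , _) }) , refl)

  S-zeros : Proper α → S α (λ _ → false) false
  S-zeros α-proper with α-proper 0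
  ... | i , _ , αi≡true with firstDifference (λ _ → false) α i (not-¬ αi≡true ∘ sym)
  ...   | d , agree , false≢αd = inj₁ ((d , agree , refl , ¬-not (false≢αd ∘ sym)) , refl)

-- Lexicographic minimum and maximum

ifZero : {A : Set} → ℕ → A → A → A
ifZero zero    x y = x
ifZero (suc _) x y = y

byState : {A : Set} → ℕ → A → A → A → A
byState s x y z = ifZero s x (ifZero (pred s) y z)

byState-map : ∀ {A B : Set} (f : A → B) s x y z → f (byState s x y z) ≡ byState s (f x) (f y) (f z)
byState-map f zero          x y z = refl
byState-map f (suc zero)    x y z = refl
byState-map f (suc (suc s)) x y z = refl

-- A finite automaton reading two digit streams in parallel; its state is
-- 0 while they agree, then 1 if the first stream went below, 2 if above.
compareStep : ℕ → ℕ → ℕ → ℕ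
compareStep s x y = ifZero s (ifZero x (ifZero y 0 1) (ifZero y 2 0)) s

comparison : (ℕ → ℕ) → (ℕ → ℕ) → ℕ → ℕ
comparison A B zero    = 0
comparison A B (suc i) = compareStep (comparison A B i) (A i) (B i)

digits : Cantor → ℕ → ℕ
digits a = b2n ∘ a

lexState : Cantor → Cantor → ℕ → ℕ
lexState a b = comparison (digits a) (digits b)

lexMin lexMax : Cantor → Cantor → Cantor
lexMin a b i = byState (lexState a b (suc i)) (a i) (a i) (b i)
lexMax a b i = byState (lexState a b (suc i)) (a i) (b i) (a i)

module _ {a b : Cantor} where

  lexState-agree : ∀ {d} → AgreeBelow d a b → ∀ i → i ≤ d → lexState a b i ≡ 0
  lexState-agree agree zero    _   = refl
  lexState-agree agree (suc i) i<d rewrite lexState-agree agree i (<⇒≤ i<d) | agree i i<d with b i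
  ... | false = refl
  ... | true  = refl

  lexState-stable : ∀ {d c} → lexState a b (suc d) ≡ suc c → ∀ i → d < i → lexState a b i ≡ suc c
  lexState-stable decided (suc i) d<1+i with m<1+n⇒m<n∨m≡n d<1+i
  ... | inj₂ refl = decided
  ... | inj₁ d<i rewrite lexState-stable decided i d<i = refl

  lexState-< : (a<b : a <lex b) → ∀ i → proj₁ a<b < i → lexState a b i ≡ 1
  lexState-< (d , agree , ad , bd) = lexState-stable decided
    where decided : lexState a b (suc d) ≡ 1
          decided rewrite lexState-agree agree d ≤-refl | ad | bd = refl

  lexState-> : (b<a : b <lex a) → ∀ i → proj₁ b<a < i → lexState a b i ≡ 2
  lexState-> (d , agree , bd , ad) = lexState-stable decided
    where decided : lexState a b (suc d) ≡ 2
          decided rewrite lexState-agree (λ j j<d → sym (agree j j<d)) d ≤-refl | ad | bd = refl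

  lexState-≗ : a ≗ b → ∀ i → lexState a b i ≡ 0
  lexState-≗ a≗b i = lexState-agree (λ j _ → a≗b j) i ≤-refl

  lexMin-≤ : a ≤lex b → lexMin a b ≗ a
  lexMin-≤ (inj₂ a≗b) i rewrite lexState-≗ a≗b (suc i) = refl
  lexMin-≤ (inj₁ a<b@(d , agree , _)) i with i <? d
  ... | yes i<d rewrite lexState-agree agree (suc i) i<d = refl
  ... | no  i≮d rewrite lexState-< a<b (suc i) (s≤s (≮⇒≥ i≮d)) = refl

  lexMax-≤ : a ≤lex b → lexMax a b ≗ b
  lexMax-≤ (inj₂ a≗b) i rewrite lexState-≗ a≗b (suc i) = a≗b i
  lexMax-≤ (inj₁ a<b@(d , agree , _)) i with i <? d
  ... | yes i<d rewrite lexState-agree agree (suc i) i<d = agree i i<d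
  ... | no  i≮d rewrite lexState-< a<b (suc i) (s≤s (≮⇒≥ i≮d)) = refl

  lexMin-> : b <lex a → lexMin a b ≗ b
  lexMin-> b<a@(d , agree , _) i with i <? d
  ... | yes i<d rewrite lexState-agree (λ j j<d → sym (agree j j<d)) (suc i) i<d = sym (agree i i<d)
  ... | no  i≮d rewrite lexState-> b<a (suc i) (s≤s (≮⇒≥ i≮d)) = refl

  lexMax-> : b <lex a → lexMax a b ≗ a
  lexMax-> b<a@(d , agree , _) i with i <? d
  ... | yes i<d rewrite lexState-agree (λ j j<d → sym (agree j j<d)) (suc i) i<d = refl
  ... | no  i≮d rewrite lexState-> b<a (suc i) (s≤s (≮⇒≥ i≮d)) = refl

module _ (em : ExcludedMiddle 0ℓ) {α : Cantor} where

  S-lexMin : ∀ {a b sa sb} → S α a sa → S α b sb → S α (lexMin a b) (sa ∧ sb)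
  S-lexMin {a} {b} {sa} {sb} Sa Sb with ≤lex-total em a b
  ... | inj₁ a≤b = S-resp-≗ (sym ∘ lexMin-≤ a≤b) (subst (S α a) (sym sa∧sb≡sa) Sa)
    where sa∧sb≡sa : sa ∧ sb ≡ sa
          sa∧sb≡sa = x≤y⇒x∧y≡x (S-monotone a≤b Sa Sb)
  ... | inj₂ b<a = S-resp-≗ (sym ∘ lexMin-> b<a) (subst (S α b) (sym sa∧sb≡sb) Sb)
    where sa∧sb≡sb : sa ∧ sb ≡ sb
          sa∧sb≡sb = trans (∧-comm sa sb) (x≤y⇒x∧y≡x (S-monotone (inj₁ b<a) Sb Sa))

  S-lexMax : ∀ {a b sa sb} → S α a sa → S α b sb → S α (lexMax a b) (sa ∨ sb)
  S-lexMax {a} {b} {sa} {sb} Sa Sb with ≤lex-total em a b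
  ... | inj₁ a≤b = S-resp-≗ (sym ∘ lexMax-≤ a≤b) (subst (S α b) (sym sa∨sb≡sb) Sb)
    where sa∨sb≡sb : sa ∨ sb ≡ sb
          sa∨sb≡sb = x≤y⇒x∨y≡y (S-monotone a≤b Sa Sb)
  ... | inj₂ b<a = S-resp-≗ (sym ∘ lexMax-> b<a) (subst (S α a) (sym sa∨sb≡sa) Sa)
    where sa∨sb≡sa : sa ∨ sb ≡ sa
          sa∨sb≡sa = trans (∨-comm sa sb) (x≤y⇒x∨y≡y (S-monotone (inj₁ b<a) Sb Sa))

-- Programs

Oracle : Set
Oracle = ℕ → ℕ → ℕ

Computes : Oracle → Code 1 → (ℕ → ℕ) → Set
Computes o p f = ∀ i → Eval o p (i ∷ []) (f i)

_∙ᶜ_ : ∀ {k} → Code 1 → Code k → Code k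
p ∙ᶜ c = comp p (c ∷ [])

constᶜ : ∀ {k} → ℕ → Code k
constᶜ zero    = zero'
constᶜ (suc c) = succ' ∙ᶜ constᶜ c

predᶜ : ∀ {k} → Code k → Code k
predᶜ c = prec zero' (proj (# 0)) ∙ᶜ c

ifZeroᶜ : ∀ {k} → Code k → Code k → Code k → Code k
ifZeroᶜ b x y = comp (prec (proj (# 0)) (proj (# 3))) (b ∷ x ∷ y ∷ [])

byStateᶜ : ∀ {k} → Code k → Code k → Code k → Code k → Code k
byStateᶜ s x y z = ifZeroᶜ s x (ifZeroᶜ (predᶜ s) y z)

compareStepᶜ : ∀ {k} → Code k → Code k → Code k → Code k
compareStepᶜ s x y =
  ifZeroᶜ s (ifZeroᶜ x (ifZeroᶜ y (constᶜ 0) (constᶜ 1)) (ifZeroᶜ y (constᶜ 2) (constᶜ 0))) s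

comparisonᶜ : Code 1 → Code 1 → Code 1
comparisonᶜ p q = prec zero' (compareStepᶜ (proj (# 1)) (p ∙ᶜ proj (# 0)) (q ∙ᶜ proj (# 0)))

shiftᶜ : Code 1 → Code 1
shiftᶜ p = p ∙ᶜ (succ' ∙ᶜ proj (# 0))

lexMinᶜ lexMaxᶜ : Code 1 → Code 1 → Code 1
lexMinᶜ p q = byStateᶜ (shiftᶜ (comparisonᶜ p q)) p p q
lexMaxᶜ p q = byStateᶜ (shiftᶜ (comparisonᶜ p q)) p q p

module _ {o : Oracle} {k} {xs : Vec ℕ k} where

  ∙-eval : ∀ {p c v w} → Eval o p (v ∷ []) w → Eval o c xs v → Eval o (p ∙ᶜ c) xs w
  ∙-eval ep ec = ev-comp (evv-cons ec evv-nil) ep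

  const-eval : ∀ c → Eval o (constᶜ c) xs c
  const-eval zero    = ev-zero
  const-eval (suc c) = ∙-eval ev-succ (const-eval c)

  pred-eval : ∀ {c v} → Eval o c xs v → Eval o (predᶜ c) xs (pred v)
  pred-eval {v = v} ec = ∙-eval (run v) ec
    where run : ∀ v → Eval o (prec zero' (proj (# 0))) (v ∷ []) (pred v)
          run zero    = ev-prec0 ev-zero
          run (suc v) = ev-precS (run v) (ev-proj (# 0))

  ifZero-eval : ∀ {b x y bv xv yv} → Eval o b xs bv → Eval o x xs xv → Eval o y xs yv →
                Eval o (ifZeroᶜ b x y) xs (ifZero bv xv yv)
  ifZero-eval {bv = bv} eb ex ey = ev-comp (evv-cons eb (evv-cons ex (evv-cons ey evv-nil))) (run bv)
    where run : ∀ bv {xv yv} → Eval o (prec (proj (# 0)) (proj (# 3))) (bv ∷ xv ∷ yv ∷ []) (ifZero bv xv yv)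
          run zero     = ev-prec0 (ev-proj (# 0))
          run (suc bv) = ev-precS (run bv) (ev-proj (# 3))

  byState-eval : ∀ {s x y z sv xv yv zv} →
                 Eval o s xs sv → Eval o x xs xv → Eval o y xs yv → Eval o z xs zv →
                 Eval o (byStateᶜ s x y z) xs (byState sv xv yv zv)
  byState-eval es ex ey ez = ifZero-eval es ex (ifZero-eval (pred-eval es) ey ez)

  compareStep-eval : ∀ {s x y sv xv yv} → Eval o s xs sv → Eval o x xs xv → Eval o y xs yv →
                     Eval o (compareStepᶜ s x y) xs (compareStep sv xv yv)
  compareStep-eval es ex ey =
    ifZero-eval es (ifZero-eval ex (ifZero-eval ey (const-eval 0) (const-eval 1))
                                   (ifZero-eval ey (const-eval 2) (const-eval 0))) es

module _ {o : Oracle} {p q : Code 1} {A B : ℕ → ℕ} (cp : Computes o p A) (cq : Computes o q B) where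

  comparison-computes : Computes o (comparisonᶜ p q) (comparison A B)
  comparison-computes zero    = ev-prec0 ev-zero
  comparison-computes (suc i) = ev-precS (comparison-computes i)
    (compareStep-eval (ev-proj (# 1)) (∙-eval (cp i) (ev-proj (# 0))) (∙-eval (cq i) (ev-proj (# 0))))

  shift-comparison-computes : Computes o (shiftᶜ (comparisonᶜ p q)) (comparison A B ∘ suc)
  shift-comparison-computes i = ∙-eval (comparison-computes (suc i)) (∙-eval ev-succ (ev-proj (# 0)))

module _ {o : Oracle} {p q : Code 1} {a b : Cantor}
         (cp : Computes o p (digits a)) (cq : Computes o q (digits b)) where

  lexMin-computes : Computes o (lexMinᶜ p q) (digits (lexMin a b))
  lexMin-computes i = subst (Eval o _ _) (sym (byState-map b2n (lexState a b (suc i)) (a i) (a i) (b i)))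
    (byState-eval (shift-comparison-computes cp cq i) (cp i) (cp i) (cq i))

  lexMax-computes : Computes o (lexMaxᶜ p q) (digits (lexMax a b))
  lexMax-computes i = subst (Eval o _ _) (sym (byState-map b2n (lexState a b (suc i)) (a i) (b i) (a i)))
    (byState-eval (shift-comparison-computes cp cq i) (cp i) (cq i) (cp i))

-- tupleᶜ m ps runs ps j on input i. Composition evaluates every argument, so the value
-- tuple m f j i of this program has to be defined for all j : ℕ, not only for j < m.
tuple : ∀ m → (Fin m → ℕ → ℕ) → ℕ → ℕ → ℕ
tuple zero    f j i = 0
tuple (suc m) f j i = ifZero j (f zero i) (tuple m (f ∘ suc) (pred j) i)

tuple-toℕ : ∀ {m} (f : Fin m → ℕ → ℕ) k i → tuple m f (toℕ k) i ≡ f k i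
tuple-toℕ f zero    i = refl
tuple-toℕ f (suc k) i = tuple-toℕ (f ∘ suc) k i

tupleᶜ : ∀ m → (Fin m → Code 1) → Code 2
tupleᶜ zero    ps = zero'
tupleᶜ (suc m) ps =
  ifZeroᶜ (proj (# 0)) (ps zero ∙ᶜ proj (# 1))
          (comp (tupleᶜ m (ps ∘ suc)) (predᶜ (proj (# 0)) ∷ proj (# 1) ∷ []))

tuple-eval : ∀ {o m} {ps : Fin m → Code 1} {f} → (∀ k → Computes o (ps k) (f k)) →
             ∀ j i → Eval o (tupleᶜ m ps) (j ∷ i ∷ []) (tuple m f j i)
tuple-eval {m = zero}  cs j i = ev-zero
tuple-eval {m = suc m} cs j i =
  ifZero-eval (ev-proj (# 0)) (∙-eval (cs zero i) (ev-proj (# 1)))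
    (ev-comp (evv-cons (pred-eval (ev-proj (# 0))) (evv-cons (ev-proj (# 1)) evv-nil))
             (tuple-eval (cs ∘ suc) (pred j) i))

tabulate-computable : ∀ {n m} (f : Vec Cantor n → Fin m → Cantor) (ps : Fin m → Code 1) →
  (∀ xs k → Computes (oracle xs) (ps k) (digits (f xs k))) → Computable (λ xs → tabulate (f xs))
tabulate-computable {m = m} f ps cs = tupleᶜ m ps , λ xs k i →
  subst (Eval (oracle xs) _ _)
    (trans (tuple-toℕ (λ k → digits (f xs k)) k i)
           (cong (λ a → b2n (a i)) (sym (lookup∘tabulate (f xs) k))))
    (tuple-eval (cs xs) (toℕ k) i)

oracle-toℕ : ∀ {n} (xs : Vec Cantor n) (j : Fin n) i → oracle xs (toℕ j) i ≡ digits (lookup xs j) i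
oracle-toℕ {n} xs j i with toℕ j <? n
... | yes j<n rewrite fromℕ<-toℕ j j<n = refl
... | no  j≮n = ⊥-elim (j≮n (toℕ<n j))

-- Monotone factorisations

data Term (n : ℕ) : Set where
  var       : Fin n → Term n
  ⊥ᵗ ⊤ᵗ     : Term n
  _∧ᵗ_ _∨ᵗ_ : Term n → Term n → Term n

⟦_⟧ᴮ : ∀ {n} → Term n → (Fin n → Bool) → Bool
⟦ var j  ⟧ᴮ w = w j
⟦ ⊥ᵗ     ⟧ᴮ w = false
⟦ ⊤ᵗ     ⟧ᴮ w = true
⟦ t ∧ᵗ u ⟧ᴮ w = ⟦ t ⟧ᴮ w ∧ ⟦ u ⟧ᴮ w
⟦ t ∨ᵗ u ⟧ᴮ w = ⟦ t ⟧ᴮ w ∨ ⟦ u ⟧ᴮ w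

⟦_⟧ᶜ : ∀ {n} → Term n → (Fin n → Cantor) → Cantor
⟦ var j  ⟧ᶜ xs = xs j
⟦ ⊥ᵗ     ⟧ᶜ xs = λ _ → false
⟦ ⊤ᵗ     ⟧ᶜ xs = λ _ → true
⟦ t ∧ᵗ u ⟧ᶜ xs = lexMin (⟦ t ⟧ᶜ xs) (⟦ u ⟧ᶜ xs)
⟦ t ∨ᵗ u ⟧ᶜ xs = lexMax (⟦ t ⟧ᶜ xs) (⟦ u ⟧ᶜ xs)

module _ (em : ExcludedMiddle 0ℓ) {α : Cantor} (α-proper : Proper α) where

  S-⟦⟧ : ∀ {n} {xs : Fin n → Cantor} {w : Fin n → Bool} →
         (∀ j → S α (xs j) (w j)) → ∀ t → S α (⟦ t ⟧ᶜ xs) (⟦ t ⟧ᴮ w)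
  S-⟦⟧ Sxs (var j)  = Sxs j
  S-⟦⟧ Sxs ⊥ᵗ       = S-zeros α-proper
  S-⟦⟧ Sxs ⊤ᵗ       = S-ones
  S-⟦⟧ Sxs (t ∧ᵗ u) = S-lexMin em (S-⟦⟧ Sxs t) (S-⟦⟧ Sxs u)
  S-⟦⟧ Sxs (t ∨ᵗ u) = S-lexMax em (S-⟦⟧ Sxs t) (S-⟦⟧ Sxs u)

termᶜ : ∀ {n} → Term n → Code 1
termᶜ (var j)  = comp orc (constᶜ (toℕ j) ∷ proj (# 0) ∷ [])
termᶜ ⊥ᵗ       = constᶜ 0
termᶜ ⊤ᵗ       = constᶜ 1
termᶜ (t ∧ᵗ u) = lexMinᶜ (termᶜ t) (termᶜ u)
termᶜ (t ∨ᵗ u) = lexMaxᶜ (termᶜ t) (termᶜ u)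

term-computes : ∀ {n} (xs : Vec Cantor n) t →
                Computes (oracle xs) (termᶜ t) (digits (⟦ t ⟧ᶜ (lookup xs)))
term-computes xs (var j)  i = subst (Eval (oracle xs) _ _) (oracle-toℕ xs j i)
  (ev-comp (evv-cons (const-eval (toℕ j)) (evv-cons (ev-proj (# 0)) evv-nil)) ev-orc)
term-computes xs ⊥ᵗ       i = const-eval 0
term-computes xs ⊤ᵗ       i = const-eval 1
term-computes xs (t ∧ᵗ u) = lexMin-computes (term-computes xs t) (term-computes xs u)
term-computes xs (t ∨ᵗ u) = lexMax-computes (term-computes xs t) (term-computes xs u)

Monotone : ∀ {m} → (Vec Bool m → Bool) → Set
Monotone M = ∀ {v w} → v ⊆b w → M v ≤ᴮ M w

-- Shannon expansion M (x ∷ v) = M (false ∷ v) ∨ (x ∧ M (true ∷ v)), valid because M is monotone;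
-- ρ places the arguments of M among the variables of the term.
monotoneTerm : ∀ {n} m → (Vec Bool m → Bool) → (Fin m → Fin n) → Term n
monotoneTerm zero    M ρ = if M [] then ⊤ᵗ else ⊥ᵗ
monotoneTerm (suc m) M ρ =
      monotoneTerm m (M ∘ (false ∷_)) (ρ ∘ suc)
  ∨ᵗ (var (ρ zero) ∧ᵗ monotoneTerm m (M ∘ (true ∷_)) (ρ ∘ suc))

⟦monotoneTerm⟧ : ∀ {n} m (M : Vec Bool m → Bool) (ρ : Fin m → Fin n) → Monotone M →
                 ∀ w → ⟦ monotoneTerm m M ρ ⟧ᴮ w ≡ M (tabulate (w ∘ ρ))
⟦monotoneTerm⟧ zero M ρ mono w with M []
... | false = refl
... | true  = refl
⟦monotoneTerm⟧ (suc m) M ρ mono w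
  rewrite ⟦monotoneTerm⟧ m (M ∘ (false ∷_)) (ρ ∘ suc) (mono ∘ ∷-⊆b false) w
        | ⟦monotoneTerm⟧ m (M ∘ (true ∷_)) (ρ ∘ suc) (mono ∘ ∷-⊆b true) w
  with w (ρ zero)
... | false = ∨-identityʳ _
... | true  = x≤y⇒x∨y≡y (mono (false∷⊆true∷ _))

module _ (em : ExcludedMiddle 0ℓ) {α : Cantor} (α-proper : Proper α) where

  monotone-factorisation⇒≤sW :
    ∀ {n m} (F : TruthTable n) (G : TruthTable m)
    (M : Fin m → Vec Bool n → Bool) → (∀ k → Monotone (M k)) →
    (Ψ : Bool → Bool) → (∀ w → F w ≡ Ψ (G (tabulate λ k → M k w))) →
    SG F α ≤sW SG G α
  monotone-factorisation⇒≤sW {n} {m} F G M M-monotone Ψ factorisation =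
    Φ , tabulate-computable Φᵏ (termᶜ ∘ t) (λ xs → term-computes xs ∘ t) , Ψ , pull-back
    where
    t : Fin m → Term n
    t k = monotoneTerm n (M k) id

    Φᵏ : Vec Cantor n → Fin m → Cantor
    Φᵏ xs k = ⟦ t k ⟧ᶜ (lookup xs)

    Φ : Vec Cantor n → Vec Cantor m
    Φ xs = tabulate (Φᵏ xs)

    pull-back : ∀ xs b → SG G α (Φ xs) b → SG F α xs (Ψ b)
    pull-back xs b (v , Sv , b≡Gv) = w , Sw , Ψb≡Fw
      where
      w : Vec Bool n
      w = tabulate λ j → proj₁ (S-total em (lookup xs j))

      Sw : ∀ j → S α (lookup xs j) (lookup w j)
      Sw j = subst (S α (lookup xs j)) (sym (lookup∘tabulate _ j)) (proj₂ (S-total em (lookup xs j)))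

      vₖ≡Mₖw : ∀ k → lookup v k ≡ M k w
      vₖ≡Mₖw k = begin
        lookup v k                       ≡⟨ S-functional (Sv k) S-Φᵏ ⟩
        ⟦ t k ⟧ᴮ (lookup w)              ≡⟨ ⟦monotoneTerm⟧ n (M k) id (M-monotone k) (lookup w) ⟩
        M k (tabulate (lookup w))        ≡⟨ cong (M k) (tabulate∘lookup w) ⟩
        M k w                            ∎
        where
        open ≡-Reasoning
        S-Φᵏ : S α (lookup (Φ xs) k) (⟦ t k ⟧ᴮ (lookup w))
        S-Φᵏ = subst (λ a → S α a (⟦ t k ⟧ᴮ (lookup w))) (sym (lookup∘tabulate (Φᵏ xs) k))
                     (S-⟦⟧ em α-proper Sw (t k))

      Ψb≡Fw : Ψ b ≡ F w
      Ψb≡Fw = begin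
        Ψ b                                ≡⟨ cong Ψ b≡Gv ⟩
        Ψ (G v)                            ≡˘⟨ cong (Ψ ∘ G) (tabulate∘lookup v) ⟩
        Ψ (G (tabulate (lookup v)))        ≡⟨ cong (Ψ ∘ G) (tabulate-cong vₖ≡Mₖw) ⟩
        Ψ (G (tabulate λ k → M k w))       ≡˘⟨ factorisation w ⟩
        F w                                ∎
        where open ≡-Reasoning

-- Alternating chains

-- An AltChain from w to e with k steps; strictness of each ⊆b step follows from F w ≢ F v.
data AltPath {n} (F : TruthTable n) : Vec Bool n → Vec Bool n → ℕ → Set where
  nil  : ∀ {w} → AltPath F w w 0
  cons : ∀ {w v e k} → w ⊆b v → F w ≢ F v → AltPath F v e k → AltPath F w e (suc k)

module _ {n} {F : TruthTable n} where

  AltPath→AltChain : ∀ {w e k} → AltPath F w e k →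
                     ∃ λ vs → AltChain F (w List.∷ vs) × length vs ≡ k
  AltPath→AltChain {w} nil = List.[] , single w , refl
  AltPath→AltChain {w} (cons {v = v} w⊆v Fw≢Fv p) with AltPath→AltChain p
  ... | vs , chain , refl = v List.∷ vs , step w v vs (w⊆v , Fw≢Fv ∘ cong F) Fw≢Fv chain , refl

  AltChain→AltPath : ∀ {w vs} → AltChain F (w List.∷ vs) → ∃ λ e → AltPath F w e (length vs)
  AltChain→AltPath (single w) = w , nil
  AltChain→AltPath (step w v vs (w⊆v , _) Fw≢Fv chain) with AltChain→AltPath chain
  ... | e , p = e , cons w⊆v Fw≢Fv p

  AltPath-snoc : ∀ {w e t k} → AltPath F w e k → e ⊆b t → F e ≢ F t → AltPath F w t (suc k)
  AltPath-snoc nil                e⊆t Fe≢Ft = cons e⊆t Fe≢Ft nil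
  AltPath-snoc (cons w⊆v Fw≢Fv p) e⊆t Fe≢Ft = cons w⊆v Fw≢Fv (AltPath-snoc p e⊆t Fe≢Ft)

  AltPath-prepend : ∀ {w w' e k} → w ⊆b w' → AltPath F w' e k →
                    ∃₂ λ e' k' → k ≤ k' × AltPath F w e' k'
  AltPath-prepend {w} w⊆w' nil = w , 0 , z≤n , nil
  AltPath-prepend {w} {w'} w⊆w' (cons {v = v} w'⊆v Fw'≢Fv p) with F w ≟ F w'
  ... | yes Fw≡Fw' =
    _ , _ , ≤-refl , cons (⊆b-trans {u = w} {w'} {v} w⊆w' w'⊆v) (Fw'≢Fv ∘ trans (sym Fw≡Fw')) p
  ... | no  Fw≢Fw' = _ , _ , n≤1+n _ , cons w⊆w' Fw≢Fw' (cons w'⊆v Fw'≢Fv p)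

  alternation-step : ∀ {w v} → F w ≢ F v → ∀ i → F v xor odd i ≡ F w xor odd (suc i)
  alternation-step {w} {v} Fw≢Fv i = begin
    F v xor odd i          ≡⟨ cong (_xor odd i) (¬-not (Fw≢Fv ∘ sym)) ⟩
    not (F w) xor odd i    ≡˘⟨ not-distribˡ-xor (F w) (odd i) ⟩
    not (F w xor odd i)    ≡⟨ not-distribʳ-xor (F w) (odd i) ⟩
    F w xor odd (suc i)    ∎
    where open ≡-Reasoning

  AltPath-parity : ∀ {w e k} → AltPath F w e k → F e ≡ F w xor odd k
  AltPath-parity {w} nil = sym (xor-identityʳ (F w))
  AltPath-parity (cons {k = k} _ Fw≢Fv p) = trans (AltPath-parity p) (alternation-step Fw≢Fv k)

  vertex : ∀ {w e k} → AltPath F w e k → ℕ → Vec Bool n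
  vertex {w} _            zero    = w
  vertex {w} nil          (suc i) = w
  vertex     (cons _ _ p) (suc i) = vertex p i

  vertex-step : ∀ {w e k} (p : AltPath F w e k) i → vertex p i ⊆b vertex p (suc i)
  vertex-step {w} nil        zero    = ⊆b-refl {v = w}
  vertex-step {w} nil        (suc i) = ⊆b-refl {v = w}
  vertex-step (cons w⊆v _ p) zero    = w⊆v
  vertex-step (cons _   _ p) (suc i) = vertex-step p i

  vertex-mono : ∀ {w e k} (p : AltPath F w e k) {i j} → i ≤ j → vertex p i ⊆b vertex p j
  vertex-mono p i≤j = go (≤⇒≤′ i≤j)
    where go : ∀ {i j} → i ≤′ j → vertex p i ⊆b vertex p j
          go {i} ≤′-refl               = ⊆b-refl {v = vertex p i}
          go {i} {suc j} (≤′-step i≤j) =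
            ⊆b-trans {u = vertex p i} {vertex p j} {vertex p (suc j)} (go i≤j) (vertex-step p j)

  vertex-parity : ∀ {w e k} (p : AltPath F w e k) i → i ≤ k → F (vertex p i) ≡ F w xor odd i
  vertex-parity {w} p                zero    _         = sym (xor-identityʳ (F w))
  vertex-parity     (cons _ Fw≢Fv p) (suc i) (s≤s i≤k) =
    trans (vertex-parity p i i≤k) (alternation-step Fw≢Fv i)

classical-maximum : ExcludedMiddle 0ℓ → (P : ℕ → Set) → P 0 → ∀ K → (∀ k → P k → k ≤ K) →
                    ∃ λ m → P m × (∀ k → P k → k ≤ m)
classical-maximum em P P0 zero    bounded = 0 , P0 , bounded
classical-maximum em P P0 (suc K) bounded with em {P (suc K)}
... | yes P1+K = suc K , P1+K , bounded
... | no  ¬P1+K = classical-maximum em P P0 K bounded′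
  where bounded′ : ∀ k → P k → k ≤ K
        bounded′ k Pk with m≤n⇒m<n∨m≡n (bounded k Pk)
        ... | inj₁ k<1+K = s≤s⁻¹ k<1+K
        ... | inj₂ refl  = ⊥-elim (¬P1+K Pk)

module Height (em : ExcludedMiddle 0ℓ) {n} (F : TruthTable n) {L}
              (bounded : ∀ c → AltChain F c → length c ≤ suc L) where

  StartsPath : Vec Bool n → ℕ → Set
  StartsPath w k = ∃ λ e → AltPath F w e k

  StartsPath-bounded : ∀ {w} k → StartsPath w k → k ≤ L
  StartsPath-bounded k (_ , p) with AltPath→AltChain p
  ... | _ , chain , refl = s≤s⁻¹ (bounded _ chain)

  height-spec : ∀ w → ∃ λ h → StartsPath w h × (∀ k → StartsPath w k → k ≤ h)
  height-spec w = classical-maximum em (StartsPath w) (w , nil) L StartsPath-bounded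

  height : Vec Bool n → ℕ
  height w = proj₁ (height-spec w)

  height-path : ∀ w → StartsPath w (height w)
  height-path w = proj₁ (proj₂ (height-spec w))

  height-maximal : ∀ {w} k → StartsPath w k → k ≤ height w
  height-maximal {w} = proj₂ (proj₂ (height-spec w))

  height≤L : ∀ w → height w ≤ L
  height≤L w = StartsPath-bounded (height w) (height-path w)

  height-antitone : ∀ {w w'} → w ⊆b w' → height w' ≤ height w
  height-antitone {w} {w'} w⊆w' with AltPath-prepend w⊆w' (proj₂ (height-path w'))
  ... | e , k , h'≤k , p = ≤-trans h'≤k (height-maximal k (e , p))

  top : Vec Bool n
  top = replicate n true

  -- A longest path from w ends where F agrees with F top, as otherwise it extends to top.
  height-parity : ∀ w → F w ≡ F top xor odd (height w)
  height-parity w with height-path w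
  ... | e , p with F e ≟ F top
  ...   | no  Fe≢Ftop = ⊥-elim (1+n≰n (height-maximal _ (top , AltPath-snoc p (⊆b-top e) Fe≢Ftop)))
  ...   | yes Fe≡Ftop = begin
    F w                     ≡˘⟨ xor-cancelʳ (F w) (odd h) ⟩
    (F w xor odd h) xor odd h ≡˘⟨ cong (_xor odd h) (AltPath-parity p) ⟩
    F e xor odd h           ≡⟨ cong (_xor odd h) Fe≡Ftop ⟩
    F top xor odd h         ∎
    where open ≡-Reasoning
          h = height w

module _ (em : ExcludedMiddle 0ℓ) {α : Cantor} (α-proper : Proper α) {n} (F : TruthTable n) where

  F≤sW⊕ : ∀ {L} → (∀ c → AltChain F c → length c ≤ suc L) → SG F α ≤sW SG (xorTT L) α
  F≤sW⊕ {L} bounded =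
    monotone-factorisation⇒≤sW em α-proper F (xorTT L) M M-monotone
                               ((F top xor odd L) xor_) factorisation
    where
    open Height em F bounded

    M : Fin L → Vec Bool n → Bool
    M k w = height w ≤ᵇ toℕ k

    M-monotone : ∀ k → Monotone (M k)
    M-monotone k w⊆w' = ≤ᵇ-antitone (toℕ k) (height-antitone w⊆w')

    factorisation : ∀ w → F w ≡ (F top xor odd L) xor xorTT L (tabulate λ k → M k w)
    factorisation w = begin
      F w                               ≡⟨ height-parity w ⟩
      F top xor odd h                   ≡˘⟨ cong (F top xor_) (odd-∸ (height≤L w)) ⟩
      F top xor (odd L xor odd (L ∸ h)) ≡˘⟨ xor-assoc (F top) (odd L) (odd (L ∸ h)) ⟩
      (F top xor odd L) xor odd (L ∸ h) ≡˘⟨ cong ((F top xor odd L) xor_) (xorTT-thresholds L h) ⟩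
      (F top xor odd L) xor xorTT L (tabulate λ k → M k w) ∎
      where open ≡-Reasoning
            h = height w

  ⊕≤sWF : ∀ {v vs} → AltChain F (v List.∷ vs) → SG (xorTT (length vs)) α ≤sW SG F α
  ⊕≤sWF {v} {vs} chain with AltChain→AltPath chain
  ... | _ , p =
    monotone-factorisation⇒≤sW em α-proper (xorTT L) F M M-monotone (F v xor_) factorisation
    where
    L = length vs

    M : Fin n → Vec Bool L → Bool
    M j u = lookup (vertex p (count T? u)) j

    M-monotone : ∀ j → Monotone (M j)
    M-monotone j {u} {u'} u⊆u' =
      ⊆b⇒lookup-≤ {v = vertex p (count T? u)} {vertex p (count T? u')}
                  (vertex-mono p (count-mono u u' u⊆u')) j

    factorisation : ∀ u → xorTT L u ≡ F v xor F (tabulate λ j → M j u)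
    factorisation u = begin
      xorTT L u                        ≡⟨ xorTT-count u ⟩
      odd c                            ≡˘⟨ xor-cancelˡ (F v) (odd c) ⟩
      F v xor (F v xor odd c)          ≡˘⟨ cong (F v xor_) (vertex-parity p c (count≤n T? u)) ⟩
      F v xor F (vertex p c)           ≡˘⟨ cong (λ x → F v xor F x) (tabulate∘lookup (vertex p c)) ⟩
      F v xor F (tabulate λ j → M j u) ∎
      where open ≡-Reasoning
            c = count T? u

mainTheorem1 : ExcludedMiddle 0ℓ →
    (n : ℕ) → 1 < n → (F : TruthTable n) → (α : Cantor) → Proper α →
    (L : ℕ) → IsL F L →
    SG F α ≡sW SG (xorTT L) α
mainTheorem1 em n _ F α α-proper L ((v List.∷ vs , chain , refl) , bounded) =
  F≤sW⊕ em α-proper F bounded , ⊕≤sWF em α-proper F chain
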